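{- (i) For all integers $n\geq1$ and $0\leq k\leq n$, $S_{n,k}$ is a $\mathbb{Z}$-linear combination of monomials $X_1^{r_1}X_2^{r_2}\cdots X_{n-k+1}^{r_{n-k+1}}$ with nonnegative integer exponents satisfying $\sum_{i}r_i=n-1$ and $\sum_i i\,r_i=2n-1-k$. (ii) For all integers $0\leq k\leq n$, $B_{n,k}$ is a $\mathbb{Z}$-linear combination of monomials $X_1^{r_1}\cdots X_{n-k+1}^{r_{n-k+1}}$ with nonnegative exponents satisfying $\sum_i r_i=k$ and $\sum_i i\,r_i=n$.
   Context: Let $R=\mathbb{Z}[X_1,X_1^{ -1},X_2,X_3,\ldots]$. Partial exponential Bell polynomials: $B_{0,0}=1$, $B_{n,0}=0$ for $n\geq1$, $B_{n,k}=0$ for $0\leq n<k$, and for $1\leq k\leq n$, $B_{n,k}=\sum \frac{n!}{r_1!\cdots r_{n-k+1}!\,(1!)^{r_1}\cdots((n-k+1)!)^{r_{n-k+1}}}X_1^{r_1}\cdots X_{n-k+1}^{r_{n-k+1}}$, summed over nonnegative integers $r_i$ with $\sum r_i=k$, $\sum i r_i=n$. Elements $S_{n,k}\in R$: $S_{0,0}=X_1^{ -1}$, $S_{n,0}=0$ ($n\geq1$), $S_{n,k}=0$ ($0\leq n<k$), and for $n\geq0$, $1\leq k\leq n+1$: $S_{n+1,k}=-(2n-1)X_2S_{n,k}+X_1\big(S_{n,k-1}+\sum_{j=1}^{n-k+1}X_{j+1}\,\partial S_{n,k}/\partial X_j\big)$. -}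

module Defs where

open import Data.Nat as ℕ using (ℕ; zero; suc; _∸_; _≤?_)
import Data.Nat.Properties as ℕP
open import Data.Nat.Base using (_!)
open import Data.Nat.DivMod using (_/_)
open import Data.Integer as ℤ using (ℤ; +_)
import Data.Integer.Properties as ℤP
open import Data.List as L using (List; []; _∷_; _++_; concatMap; upTo)
open import Data.Vec as V using (Vec; []; _∷_)
open import Data.Fin using (Fin; toℕ)
open import Data.Bool using (Bool; true; false; _∧_; if_then_else_)
open import Data.Product using (_×_; _,_; Σ; ∃)
open import Relation.Nullary using (does)
open import Relation.Binary.PropositionalEquality using (_≡_)

-- Monomials of R = ℤ[X₁, X₁⁻¹, X₂, X₃, …]
-- e1 = exponent of X₁ (an integer), es = exponents of X₂, X₃, … (a list,
-- absent entries are 0).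

record Mono : Set where
  constructor mono
  field
    e1 : ℤ
    es : List ℕ
open Mono public

-- exponent of the variable X_{i+1}
expo : Mono → ℕ → ℤ
expo m zero = e1 m
expo m (suc i) = + lk (es m) i
  where
  lk : List ℕ → ℕ → ℕ
  lk [] _ = 0
  lk (x ∷ _) zero = x
  lk (_ ∷ xs) (suc j) = lk xs j

-- decidable (boolean) equality of monomials (lists equal up to trailing zeros)
private
  isZero : ℕ → Bool
  isZero zero = true
  isZero (suc _) = false

  eqL : List ℕ → List ℕ → Bool
  eqL [] [] = true
  eqL [] (y ∷ ys) = isZero y ∧ eqL [] ys
  eqL (x ∷ xs) [] = isZero x ∧ eqL xs []
  eqL (x ∷ xs) (y ∷ ys) = does (x ℕ.≟ y) ∧ eqL xs ys

eqMono : Mono → Mono → Bool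
eqMono m m' = does (e1 m ℤ.≟ e1 m') ∧ eqL (es m) (es m')

-- Elements of R, represented as finite formal sums of terms c·m.
-- The actual element is determined by `coeff` (coefficients of equal
-- monomials are added).

Poly : Set
Poly = List (ℤ × Mono)

coeff : Poly → Mono → ℤ
coeff [] m = + 0
coeff ((c , m') ∷ p) m = (if eqMono m' m then c else + 0) ℤ.+ coeff p m

zeroP : Poly
zeroP = []

_⊕_ : Poly → Poly → Poly
p ⊕ q = p ++ q

scale : ℤ → Poly → Poly
scale a = L.map (λ { (c , m) → (a ℤ.* c , m) })

private
  incAt : ℕ → List ℕ → List ℕ
  incAt zero [] = 1 ∷ []
  incAt zero (x ∷ xs) = suc x ∷ xs
  incAt (suc i) [] = 0 ∷ incAt i []
  incAt (suc i) (x ∷ xs) = x ∷ incAt i xs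

  decAt : ℕ → List ℕ → List ℕ
  decAt _ [] = []
  decAt zero (x ∷ xs) = (x ∸ 1) ∷ xs
  decAt (suc i) (x ∷ xs) = x ∷ decAt i xs

mulVarM : ℕ → Mono → Mono
mulVarM zero (mono a l) = mono (a ℤ.+ + 1) l
mulVarM (suc i) (mono a l) = mono a (incAt i l)

mulVar : ℕ → Poly → Poly
mulVar i = L.map (λ { (c , m) → (c , mulVarM i m) })

derivT : ℕ → ℤ × Mono → ℤ × Mono
derivT zero (c , mono a l) = (c ℤ.* a , mono (a ℤ.- + 1) l)
derivT (suc i) (c , m@(mono a l)) = (c ℤ.* expo m (suc i) , mono a (decAt i l))

deriv : ℕ → Poly → Poly
deriv i = L.map (derivT i)

-- Σ_{j=1}^{N} X_{j+1} ∂p/∂X_j  (variable X_{j} has index j-1)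
sumXD : ℕ → Poly → Poly
sumXD N p = L.foldr (λ i acc → mulVar (suc i) (deriv i p) ⊕ acc) zeroP (upTo N)

X1inv : Poly
X1inv = (+ 1 , mono (ℤ.- (+ 1)) []) ∷ []

S : ℕ → ℕ → Poly
S zero zero = X1inv
S zero (suc k) = zeroP
S (suc n) zero = zeroP
S (suc n) (suc k) with suc k ≤? suc n
... | Relation.Nullary.yes _ =
  scale (ℤ.- ((+ 2 ℤ.* + n) ℤ.- + 1)) (mulVar 1 (S n (suc k)))
  ⊕ mulVar 0 (S n k ⊕ sumXD (suc n ∸ suc k) (S n (suc k)))
... | Relation.Nullary.no _ = zeroP

vecsUpTo : (N b : ℕ) → List (Vec ℕ N)
vecsUpTo zero b = [] ∷ []
vecsUpTo (suc N) b =
  concatMap (λ x → L.map (x ∷_) (vecsUpTo N b)) (upTo (suc b))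

wsum : ∀ {N} → Vec ℕ N → ℕ
wsum {N} r = V.sum (V.zipWith ℕ._*_ (V.tabulate (λ (i : Fin N) → suc (toℕ i))) r)

-- exact division when the denominator is nonzero (denominators below are
-- products of factorials, hence nonzero)
safeDiv : ℕ → ℕ → ℕ
safeDiv a zero = 0
safeDiv a (suc d) = a / suc d

bellDen : ∀ {N} → Vec ℕ N → ℕ
bellDen {N} r = V.foldr _ ℕ._*_ 1 (V.zipWith (λ i ri → (ri !) ℕ.* ((suc (toℕ i) !) ℕ.^ ri))
                                      (V.tabulate (λ (i : Fin N) → i)) r)

monoOfList : List ℕ → Mono
monoOfList [] = mono (+ 0) []
monoOfList (x ∷ xs) = mono (+ x) xs

B : ℕ → ℕ → Poly
B zero zero = (+ 1 , mono (+ 0) []) ∷ []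
B (suc n) zero = zeroP
B n (suc k) with suc k ≤? n
... | Relation.Nullary.no _ = zeroP
... | Relation.Nullary.yes _ =
  L.map (λ r → (+ safeDiv (n !) (bellDen r) , monoOfList (V.toList r)))
        (L.filter (λ r → (V.sum r ℕ.≟ suc k) Relation.Nullary.×-dec (wsum r ℕ.≟ n))
                  (vecsUpTo (n ∸ suc k ℕ.+ 1) n))

IsShapedMono : (N s w : ℕ) → Mono → Set
IsShapedMono N s w m =
  Σ (Vec ℕ N) λ r →
    (∀ (i : Fin N) → expo m (toℕ i) ≡ + V.lookup r i)
    × (∀ (i : ℕ) → N ℕ.≤ i → expo m i ≡ + 0)
    × (V.sum r ≡ s)
    × (wsum r ≡ w)

module Submission where

-- A monomial with natural exponents f (f i = exponent of X_{i+1}) vanishing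
-- from index N on has *shape* (N, s, w) when its degree Σ f i is s and its
-- weight Σ (i+1)·f i is w.  Reading
-- the recursion for S_{n+1,k} through these rules shows, by induction on
-- n = k + d + 1, that S_{k+d+1,k+1} is *supported* on monomials of shape
-- (d+1, k+d, k+2d): each term has coefficient 0 or a monomial of that shape.
-- Support passes to every monomial with nonzero coefficient.  For B_{n,k}
-- the support property is immediate from its definition as a filtered sum.

open import Defs
open import Data.Nat using (ℕ; _≤_; _∸_; _+_; _*_)
open import Data.Integer using (ℤ; +_)
open import Data.Product using (_×_)
open import Relation.Binary.PropositionalEquality using (_≢_)

open import Data.Nat as ℕ using (zero; suc; _<_; z≤n; s≤s; _≤?_)
import Data.Nat.Properties as ℕP
import Data.Integer as ℤ
import Data.Integer.Properties as ℤP
open import Data.List as L using (List; []; _∷_)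
import Data.List.Properties as LP
open import Data.List.Relation.Unary.All as All using (All; []; _∷_)
import Data.List.Relation.Unary.All.Properties as AllP
open import Data.Vec as V using (Vec; []; _∷_)
import Data.Vec.Properties as VP
open import Data.Fin as F using (Fin; toℕ)
open import Data.Bool using (true; false; T)
open import Data.Product using (Σ; _,_; proj₁; proj₂)
open import Data.Sum using (_⊎_; inj₁; inj₂; map₂)
open import Data.Empty using (⊥-elim)
open import Relation.Nullary using (yes; no; Dec; _×-dec_)
open import Relation.Binary.PropositionalEquality
  using (_≡_; refl; sym; trans; cong; cong₂; subst; subst₂; module ≡-Reasoning)
open import Data.Nat.Tactic.RingSolver using (solve-∀)

lookupOr0 : List ℕ → ℕ → ℕ
lookupOr0 [] _ = 0
lookupOr0 (x ∷ _) zero = x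
lookupOr0 (_ ∷ xs) (suc j) = lookupOr0 xs j

expo-suc : ∀ a l i → expo (mono a l) (suc i) ≡ + lookupOr0 l i
expo-suc a [] i = refl
expo-suc a (x ∷ l) zero = refl
expo-suc a (x ∷ l) (suc i) = expo-suc a l i

lookup-mul-same : ∀ j a l → lookupOr0 (es (mulVarM (suc j) (mono a l))) j ≡ suc (lookupOr0 l j)
lookup-mul-same zero a [] = refl
lookup-mul-same zero a (x ∷ l) = refl
lookup-mul-same (suc j) a [] = lookup-mul-same j a []
lookup-mul-same (suc j) a (x ∷ l) = lookup-mul-same j a l

lookup-mul-other : ∀ i j a l → i ≢ j → lookupOr0 (es (mulVarM (suc j) (mono a l))) i ≡ lookupOr0 l i
lookup-mul-other zero zero a l i≢j = ⊥-elim (i≢j refl)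
lookup-mul-other (suc i) zero a [] i≢j = refl
lookup-mul-other (suc i) zero a (x ∷ l) i≢j = refl
lookup-mul-other zero (suc j) a [] i≢j = refl
lookup-mul-other zero (suc j) a (x ∷ l) i≢j = refl
lookup-mul-other (suc i) (suc j) a [] i≢j = lookup-mul-other i j a [] (λ e → i≢j (cong suc e))
lookup-mul-other (suc i) (suc j) a (x ∷ l) i≢j = lookup-mul-other i j a l (λ e → i≢j (cong suc e))

lookup-der-same : ∀ j c a l → lookupOr0 (es (proj₂ (derivT (suc j) (c , mono a l)))) j ≡ lookupOr0 l j ∸ 1
lookup-der-same j c a [] = refl
lookup-der-same zero c a (x ∷ l) = refl
lookup-der-same (suc j) c a (x ∷ l) = lookup-der-same j c a l

lookup-der-other : ∀ i j c a l → i ≢ j → lookupOr0 (es (proj₂ (derivT (suc j) (c , mono a l)))) i ≡ lookupOr0 l i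
lookup-der-other i j c a [] i≢j = refl
lookup-der-other zero zero c a (x ∷ l) i≢j = ⊥-elim (i≢j refl)
lookup-der-other (suc i) zero c a (x ∷ l) i≢j = refl
lookup-der-other zero (suc j) c a (x ∷ l) i≢j = refl
lookup-der-other (suc i) (suc j) c a (x ∷ l) i≢j = lookup-der-other i j c a l (λ e → i≢j (cong suc e))

HasExps : Mono → (ℕ → ℕ) → Set
HasExps m f = ∀ i → expo m i ≡ + f i

setAt : (ℕ → ℕ) → ℕ → ℕ → ℕ → ℕ
setAt f J t i with i ℕ.≟ J
... | yes _ = t
... | no _ = f i

setAt-same : ∀ f J t → setAt f J t J ≡ t
setAt-same f J t with J ℕ.≟ J
... | yes _ = refl
... | no J≢J = ⊥-elim (J≢J refl)

setAt-other : ∀ f J t i → i ≢ J → setAt f J t i ≡ f i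
setAt-other f J t i i≢J with i ℕ.≟ J
... | yes i≡J = ⊥-elim (i≢J i≡J)
... | no _ = refl

mulVar-exps : ∀ J m f → HasExps m f → HasExps (mulVarM J m) (setAt f J (suc (f J)))
mulVar-exps J m@(mono a l) f ex i = byCase (i ℕ.≟ J)
  where
  other : ∀ J i → i ≢ J → expo (mulVarM J m) i ≡ expo m i
  other zero zero i≢J = ⊥-elim (i≢J refl)
  other zero (suc i) i≢J = refl
  other (suc j) zero i≢J = refl
  other (suc j) (suc i) i≢J =
    trans (expo-suc a (es (mulVarM (suc j) m)) i)
      (trans (cong +_ (lookup-mul-other i j a l (λ e → i≢J (cong suc e)))) (sym (expo-suc a l i)))
  same : ∀ J → expo m J ≡ + f J → expo (mulVarM J m) J ≡ + suc (f J)
  same zero refl = cong +_ (ℕP.+-comm (f zero) 1)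
  same (suc j) e =
    trans (expo-suc a (es (mulVarM (suc j) m)) j)
      (trans (cong +_ (lookup-mul-same j a l))
        (cong (λ z → + suc z) (ℤP.+-injective (trans (sym (expo-suc a l j)) e))))
  byCase : Dec (i ≡ J) → expo (mulVarM J m) i ≡ + setAt f J (suc (f J)) i
  byCase (yes refl) = trans (same J (ex J)) (cong +_ (sym (setAt-same f J _)))
  byCase (no i≢J) = trans (other J i i≢J) (trans (ex i) (cong +_ (sym (setAt-other f J _ i i≢J))))

derivT-coeff : ∀ i c m → proj₁ (derivT i (c , m)) ≡ c ℤ.* expo m i
derivT-coeff zero c (mono a l) = refl
derivT-coeff (suc i) c (mono a l) = refl

derivT-exps : ∀ i c m f t → HasExps m f → f i ≡ suc t →
              HasExps (proj₂ (derivT i (c , m))) (setAt f i t)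
derivT-exps i c m@(mono a l) f t ex fi j = byCase (j ℕ.≟ i)
  where
  other : ∀ i j → j ≢ i → expo (proj₂ (derivT i (c , m))) j ≡ expo m j
  other zero zero j≢i = ⊥-elim (j≢i refl)
  other zero (suc j) j≢i = refl
  other (suc i) zero j≢i = refl
  other (suc i) (suc j) j≢i =
    trans (expo-suc a (es (proj₂ (derivT (suc i) (c , m)))) j)
      (trans (cong +_ (lookup-der-other j i c a l (λ e → j≢i (cong suc e)))) (sym (expo-suc a l j)))
  same : ∀ i → expo m i ≡ + suc t → expo (proj₂ (derivT i (c , m))) i ≡ + t
  same zero refl = refl
  same (suc j) e =
    trans (expo-suc a (es (proj₂ (derivT (suc j) (c , m)))) j)
      (cong +_ (trans (lookup-der-same j c a l)
        (cong (_∸ 1) (ℤP.+-injective (trans (sym (expo-suc a l j)) e)))))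
  byCase : Dec (j ≡ i) → expo (proj₂ (derivT i (c , m))) j ≡ + setAt f i t j
  byCase (yes refl) = trans (same i (trans (ex i) (cong +_ fi))) (cong +_ (sym (setAt-same f i t)))
  byCase (no j≢i) = trans (other i j j≢i) (trans (ex j) (cong +_ (sym (setAt-other f i t j j≢i))))

sumTo : ℕ → (ℕ → ℕ) → ℕ
sumTo zero f = 0
sumTo (suc N) f = f 0 + sumTo N (λ i → f (suc i))

weightTo : ℕ → (ℕ → ℕ) → ℕ
weightTo N f = sumTo N (λ i → suc i * f i)

sumTo-ext : ∀ N g h → (∀ i → g i ≡ h i) → sumTo N g ≡ sumTo N h
sumTo-ext zero g h e = refl
sumTo-ext (suc N) g h e = cong₂ _+_ (e 0) (sumTo-ext N _ _ (λ i → e (suc i)))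

sumTo-extend : ∀ N M g → (∀ i → N ≤ i → g i ≡ 0) → N ≤ M → sumTo M g ≡ sumTo N g
sumTo-extend zero zero g g0 N≤M = refl
sumTo-extend zero (suc M) g g0 N≤M =
  cong₂ _+_ (g0 0 z≤n) (sumTo-extend zero M _ (λ i _ → g0 (suc i) z≤n) z≤n)
sumTo-extend (suc N) (suc M) g g0 (s≤s N≤M) =
  cong (λ z → g 0 + z) (sumTo-extend N M _ (λ i le → g0 (suc i) (s≤s le)) N≤M)

sumTo-increase : ∀ N g h J d → J < N → (∀ i → i ≢ J → h i ≡ g i) → h J ≡ d + g J →
                 sumTo N h ≡ d + sumTo N g
sumTo-increase (suc N) g h zero d _ other same =
  begin
    h 0 + sumTo N (λ i → h (suc i))
  ≡⟨ cong₂ _+_ same (sumTo-ext N _ _ (λ i → other (suc i) (λ ()))) ⟩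
    d + g 0 + sumTo N (λ i → g (suc i))
  ≡⟨ ℕP.+-assoc d _ _ ⟩
    d + (g 0 + sumTo N (λ i → g (suc i)))
  ∎
  where open ≡-Reasoning
sumTo-increase (suc N) g h (suc J) d (s≤s J<N) other same =
  begin
    h 0 + sumTo N (λ i → h (suc i))
  ≡⟨ cong₂ _+_ (other 0 (λ ()))
       (sumTo-increase N _ _ J d J<N (λ i i≢J → other (suc i) (λ e → i≢J (ℕP.suc-injective e))) same) ⟩
    g 0 + (d + sumTo N (λ i → g (suc i)))
  ≡⟨ swap (g 0) d _ ⟩
    d + (g 0 + sumTo N (λ i → g (suc i)))
  ∎
  where
  open ≡-Reasoning
  swap : ∀ a b c → a + (b + c) ≡ b + (a + c)
  swap = solve-∀

Bump : ℕ → (ℕ → ℕ) → (ℕ → ℕ) → Set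
Bump J f h = (∀ i → i ≢ J → h i ≡ f i) × h J ≡ suc (f J)

setAt-bump : ∀ f J → Bump J f (setAt f J (suc (f J)))
setAt-bump f J = setAt-other f J _ , setAt-same f J _

unsetAt-bump : ∀ f J t → f J ≡ suc t → Bump J (setAt f J t) f
unsetAt-bump f J t fJ =
  (λ i i≢J → sym (setAt-other f J t i i≢J)) , trans fJ (cong suc (sym (setAt-same f J t)))

bump-degree : ∀ N J f h → J < N → Bump J f h → sumTo N h ≡ suc (sumTo N f)
bump-degree N J f h J<N (other , same) = sumTo-increase N f h J 1 J<N other same

bump-weight : ∀ N J f h → J < N → Bump J f h → weightTo N h ≡ suc J + weightTo N f
bump-weight N J f h J<N (other , same) =
  sumTo-increase N _ _ J (suc J) J<N (λ i i≢J → cong (suc i *_) (other i i≢J))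
    (trans (cong (suc J *_) same) (ℕP.*-suc (suc J) (f J)))

record Shape (N s w : ℕ) (m : Mono) : Set where
  field
    exps : ℕ → ℕ
    hasExps : HasExps m exps
    support : ∀ i → N ≤ i → exps i ≡ 0
    degree : sumTo N exps ≡ s
    weight : weightTo N exps ≡ w
open Shape

shape-cast : ∀ {N s w s' w' m} → s ≡ s' → w ≡ w' → Shape N s w m → Shape N s' w' m
shape-cast refl refl sh = sh

shape-widen : ∀ {N N' s w m} → N ≤ N' → Shape N s w m → Shape N' s w m
shape-widen {N} {N'} N≤N' sh = record
  { exps = exps sh
  ; hasExps = hasExps sh
  ; support = λ i N'≤i → support sh i (ℕP.≤-trans N≤N' N'≤i)
  ; degree = trans (sumTo-extend N N' _ (support sh) N≤N') (degree sh)
  ; weight = trans (sumTo-extend N N' _ weight0 N≤N') (weight sh)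
  }
  where
  weight0 : ∀ i → N ≤ i → suc i * exps sh i ≡ 0
  weight0 i N≤i = trans (cong (suc i *_) (support sh i N≤i)) (ℕP.*-zeroʳ (suc i))

setAt-support : ∀ N f J t → J < N → (∀ i → N ≤ i → f i ≡ 0) → ∀ i → N ≤ i → setAt f J t i ≡ 0
setAt-support N f J t J<N f0 i N≤i =
  trans (setAt-other f J t i (λ i≡J → ℕP.<-irrefl refl (ℕP.<-≤-trans (subst (_< N) (sym i≡J) J<N) N≤i)))
        (f0 i N≤i)

shape-mulVar : ∀ {N s w} J m → J < N → Shape N s w m → Shape N (suc s) (suc J + w) (mulVarM J m)
shape-mulVar {N} J m J<N sh = record
  { exps = setAt f J (suc (f J))
  ; hasExps = mulVar-exps J m f (hasExps sh)
  ; support = setAt-support N f J _ J<N (support sh)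
  ; degree = trans (bump-degree N J f _ J<N (setAt-bump f J)) (cong suc (degree sh))
  ; weight = trans (bump-weight N J f _ J<N (setAt-bump f J)) (cong (λ z → suc J + z) (weight sh))
  }
  where f = exps sh

positive-below : ∀ {N s w m} (sh : Shape N s w m) i t → exps sh i ≡ suc t → i < N
positive-below {N} sh i t fi with N ≤? i
... | yes N≤i = ⊥-elim (ℕP.0≢1+n (trans (sym (support sh i N≤i)) fi))
... | no N≰i = ℕP.≰⇒> N≰i

shape-XD : ∀ {N s w} i c m → Shape N s w m →
           proj₁ (derivT i (c , m)) ≡ + 0
           ⊎ Shape (suc N) s (suc w) (mulVarM (suc i) (proj₂ (derivT i (c , m))))
shape-XD {N} {s} {w} i c m sh with exps sh i in fi
... | zero = inj₁ (trans (derivT-coeff i c m) (trans (cong (λ e → c ℤ.* e) (trans (hasExps sh i) (cong +_ fi))) (ℤP.*-zeroʳ c)))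
  where f = exps sh
... | suc t = inj₂ (shape-cast (sym s≡) (cong suc (sym w≡))
                     (shape-mulVar (suc i) _ (s≤s i<N) (shape-widen (ℕP.n≤1+n N) lowered)))
  where
  f = exps sh
  i<N = positive-below sh i t fi
  bump = unsetAt-bump f i t fi
  lowered : Shape N (sumTo N (setAt f i t)) (weightTo N (setAt f i t)) (proj₂ (derivT i (c , m)))
  lowered = record
    { exps = setAt f i t
    ; hasExps = derivT-exps i c m f t (hasExps sh) fi
    ; support = setAt-support N f i t i<N (support sh)
    ; degree = refl
    ; weight = refl
    }
  s≡ : s ≡ suc (sumTo N (setAt f i t))
  s≡ = trans (sym (degree sh)) (bump-degree N i _ f i<N bump)
  w≡ : w ≡ suc i + weightTo N (setAt f i t)
  w≡ = trans (sym (weight sh)) (bump-weight N i _ f i<N bump)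

Supported : (Mono → Set) → Poly → Set
Supported P = All (λ t → proj₁ t ≡ + 0 ⊎ P (proj₂ t))

supported-map : ∀ {P Q : Mono → Set} (φ : ℤ × Mono → ℤ × Mono) →
  (∀ m → proj₁ (φ (+ 0 , m)) ≡ + 0) →
  (∀ c m → P m → proj₁ (φ (c , m)) ≡ + 0 ⊎ Q (proj₂ (φ (c , m)))) →
  ∀ p → Supported P p → Supported Q (L.map φ p)
supported-map φ zero↦zero step p sp = AllP.map⁺ (All.map term sp)
  where
  term : ∀ {t} → proj₁ t ≡ + 0 ⊎ _ → _
  term {c , m} (inj₁ refl) = inj₁ (zero↦zero m)
  term {c , m} (inj₂ pm) = step c m pm

supported-scale : ∀ {P} z p → Supported P p → Supported P (scale z p)
supported-scale z = supported-map _ (λ _ → ℤP.*-zeroʳ z) (λ _ _ pm → inj₂ pm)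

supported-mulVar : ∀ {P Q : Mono → Set} J → (∀ m → P m → Q (mulVarM J m)) →
                   ∀ p → Supported P p → Supported Q (mulVar J p)
supported-mulVar J h = supported-map _ (λ _ → refl) (λ _ m pm → inj₂ (h m pm))

supported-sumXD : ∀ {P Q : Mono → Set} →
  (∀ i c m → P m → proj₁ (derivT i (c , m)) ≡ + 0 ⊎ Q (mulVarM (suc i) (proj₂ (derivT i (c , m))))) →
  ∀ p → Supported P p → ∀ N → Supported Q (sumXD N p)
supported-sumXD {Q = Q} h p sp N = go (L.upTo N)
  where
  XD : ∀ i → Supported Q (mulVar (suc i) (deriv i p))
  XD i = supported-mulVar (suc i) (λ _ q → q) _
           (supported-map _ (λ m → trans (derivT-coeff i (+ 0) m) (ℤP.*-zeroˡ (expo m i))) (h i) p sp)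
  go : ∀ xs → Supported Q (L.foldr (λ i acc → mulVar (suc i) (deriv i p) ⊕ acc) zeroP xs)
  go [] = []
  go (x ∷ xs) = AllP.++⁺ (XD x) (go xs)

SameExps : Mono → Mono → Set
SameExps m m' = ∀ i → expo m i ≡ expo m' i

eqMono-tail : ∀ xs ys → eqMono (mono (+ 0) xs) (mono (+ 0) ys) ≡ true → ∀ j → lookupOr0 xs j ≡ lookupOr0 ys j
eqMono-tail [] [] e j = refl
eqMono-tail [] (zero ∷ ys) e zero = refl
eqMono-tail [] (zero ∷ ys) e (suc j) = eqMono-tail [] ys e j
eqMono-tail (zero ∷ xs) [] e zero = refl
eqMono-tail (zero ∷ xs) [] e (suc j) = eqMono-tail xs [] e j
eqMono-tail (x ∷ xs) (y ∷ ys) e j with x ℕ.≡ᵇ y in x≡ᵇy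
eqMono-tail (x ∷ xs) (y ∷ ys) e zero | true = ℕP.≡ᵇ⇒≡ x y (subst T (sym x≡ᵇy) _)
eqMono-tail (x ∷ xs) (y ∷ ys) e (suc j) | true = eqMono-tail xs ys e j
eqMono-tail (x ∷ xs) (y ∷ ys) () j | false

eqMono-sameExps : ∀ m m' → eqMono m m' ≡ true → SameExps m m'
eqMono-sameExps (mono a xs) (mono b ys) e i with a ℤ.≟ b
eqMono-sameExps (mono a xs) (mono b ys) e zero | yes a≡b = a≡b
eqMono-sameExps (mono a xs) (mono b ys) e (suc i) | yes _ =
  trans (expo-suc a xs i) (trans (cong +_ (eqMono-tail xs ys e i)) (sym (expo-suc b ys i)))
eqMono-sameExps (mono a xs) (mono b ys) () i | no _

coeff-support : ∀ {P : Mono → Set} p m → Supported P p → coeff p m ≢ + 0 →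
                Σ Mono λ m' → P m' × SameExps m' m
coeff-support [] m sp c≢0 = ⊥-elim (c≢0 refl)
coeff-support ((c , m') ∷ p) m (h ∷ sp) c≢0 with eqMono m' m in m'≟m
coeff-support ((c , m') ∷ p) m (inj₂ pm' ∷ sp) c≢0 | true = m' , pm' , eqMono-sameExps m' m m'≟m
coeff-support ((c , m') ∷ p) m (inj₁ refl ∷ sp) c≢0 | true =
  coeff-support p m sp (λ e → c≢0 (trans (ℤP.+-identityˡ _) e))
coeff-support ((c , m') ∷ p) m (h ∷ sp) c≢0 | false =
  coeff-support p m sp (λ e → c≢0 (trans (ℤP.+-identityˡ _) e))

isShaped-transport : ∀ {N s w} m' m → SameExps m' m → IsShapedMono N s w m' → IsShapedMono N s w m
isShaped-transport m' m same (r , ex , out , hs , hw) =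
  r , (λ i → trans (sym (same (toℕ i))) (ex i)) , (λ i le → trans (sym (same i)) (out i le)) , hs , hw

isShaped-of-coeff : ∀ {N s w} p m → Supported (IsShapedMono N s w) p → coeff p m ≢ + 0 →
                    IsShapedMono N s w m
isShaped-of-coeff p m sp c≢0 with coeff-support p m sp c≢0
... | m' , sh , same = isShaped-transport m' m same sh

sum-tabulate : ∀ N (f : ℕ → ℕ) → V.sum (V.tabulate {n = N} (λ i → f (toℕ i))) ≡ sumTo N f
sum-tabulate zero f = refl
sum-tabulate (suc N) f = cong (λ z → f 0 + z) (sum-tabulate N (λ i → f (suc i)))

wsum-tabulate : ∀ N (f : ℕ → ℕ) → wsum (V.tabulate {n = N} (λ i → f (toℕ i))) ≡ weightTo N f
wsum-tabulate N f = go N suc f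
  where
  go : ∀ N (g f : ℕ → ℕ) →
       V.sum (V.zipWith _*_ (V.tabulate {n = N} (λ i → g (toℕ i))) (V.tabulate (λ i → f (toℕ i))))
       ≡ sumTo N (λ i → g i * f i)
  go zero g f = refl
  go (suc N) g f = cong (λ z → g 0 * f 0 + z) (go N (λ i → g (suc i)) (λ i → f (suc i)))

shape⇒isShaped : ∀ {N s w} m → Shape N s w m → IsShapedMono N s w m
shape⇒isShaped {N} m sh =
  V.tabulate (λ i → exps sh (toℕ i)) ,
  (λ i → trans (hasExps sh (toℕ i)) (cong +_ (sym (VP.lookup∘tabulate (λ i → exps sh (toℕ i)) i)))) ,
  (λ i N≤i → trans (hasExps sh i) (cong +_ (support sh i N≤i))) ,
  trans (sum-tabulate N (exps sh)) (degree sh) ,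
  trans (wsum-tabulate N (exps sh)) (weight sh)

S-above-diagonal : ∀ k → S k (suc k) ≡ zeroP
S-above-diagonal zero = refl
S-above-diagonal (suc k) with suc (suc k) ≤? suc k
... | yes k+2≤k+1 = ⊥-elim (ℕP.<-irrefl refl k+2≤k+1)
... | no _ = refl

SShape : ℕ → ℕ → Mono → Set
SShape k d = Shape (suc d) (k + d) (k + d + d)

S-row-shift : ∀ k d → S (k + suc d) (suc k) ≡ S (suc (k + d)) (suc k)
S-row-shift k d = cong (λ n → S n (suc k)) (ℕP.+-suc k d)

weight-shift₂ : ∀ k d → 2 + (k + d + d) ≡ k + suc d + suc d
weight-shift₂ = solve-∀

weight-shift₁ : ∀ k d → suc (suc (k + d + d)) ≡ k + suc d + suc d
weight-shift₁ = solve-∀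

-- X₁⁻¹·X₁ = 1 has the shape of S_{1,1}.
unit-shape : Shape 1 0 0 (mulVarM 0 (mono (ℤ.- (+ 1)) []))
unit-shape = record
  { exps = λ _ → 0 ; hasExps = unit ; support = λ _ _ → refl ; degree = refl ; weight = refl }
  where
  unit : HasExps (mulVarM 0 (mono (ℤ.- (+ 1)) [])) (λ _ → 0)
  unit zero = refl
  unit (suc i) = refl

-- Induction on n = k + d + 1 along the recursion
--   S_{n+1,k+1} = -(2n-1) X₂ S_{n,k+1} + X₁ (S_{n,k} + Σ_j X_{j+1} ∂S_{n,k+1}/∂X_j).
mutual
  S-supported : ∀ k d → Supported (SShape k d) (S (suc (k + d)) (suc k))
  S-supported k d with suc k ≤? suc (k + d)
  ... | no k≰k+d = ⊥-elim (k≰k+d (s≤s (ℕP.m≤m+n k d)))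
  ... | yes _ =
    AllP.++⁺ (X₂-term k d (ℤ.- ((+ 2 ℤ.* + (k + d)) ℤ.- + 1)))
      (subst (Supported (SShape k d)) (sym (LP.map-++ _ (S (k + d) k) _))
        (AllP.++⁺ (X₁-term k d) (XD-term k d)))

  previous-row : ∀ k d → Supported (SShape k d) (S (k + suc d) (suc k))
  previous-row k d = subst (Supported (SShape k d)) (sym (S-row-shift k d)) (S-supported k d)

  X₂-term : ∀ k d z → Supported (SShape k d) (scale z (mulVar 1 (S (k + d) (suc k))))
  X₂-term k zero z =
    subst (λ p → Supported (SShape k 0) (scale z (mulVar 1 p)))
      (sym (trans (cong (λ n → S n (suc k)) (ℕP.+-identityʳ k)) (S-above-diagonal k))) []
  X₂-term k (suc d) z =
    supported-scale z _ (supported-mulVar 1 X₂-shape _ (previous-row k d))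
    where
    X₂-shape : ∀ m → SShape k d m → SShape k (suc d) (mulVarM 1 m)
    X₂-shape m sh = shape-cast (sym (ℕP.+-suc k d)) (weight-shift₂ k d)
                      (shape-mulVar 1 m (s≤s (s≤s z≤n)) (shape-widen (ℕP.n≤1+n (suc d)) sh))

  X₁-term : ∀ k d → Supported (SShape k d) (mulVar 0 (S (k + d) k))
  X₁-term zero zero = inj₂ unit-shape ∷ []
  X₁-term zero (suc d) = []
  X₁-term (suc k) d = supported-mulVar 0 (λ m → shape-mulVar 0 m (s≤s z≤n)) _ (S-supported k d)

  XD-term : ∀ k d → Supported (SShape k d) (mulVar 0 (sumXD (suc (k + d) ∸ suc k) (S (k + d) (suc k))))
  XD-term k zero rewrite ℕP.+-identityʳ k | S-above-diagonal k | ℕP.n∸n≡0 k = []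
  XD-term k (suc d) =
    supported-mulVar 0 X₁-shape _
      (supported-sumXD shape-XD _ (previous-row k d) (suc (k + suc d) ∸ suc k))
    where
    X₁-shape : ∀ m → Shape (suc (suc d)) (k + d) (suc (k + d + d)) m → SShape k (suc d) (mulVarM 0 m)
    X₁-shape m sh = shape-cast (sym (ℕP.+-suc k d)) (weight-shift₁ k d) (shape-mulVar 0 m (s≤s z≤n) sh)

-- Part (i) in the parametrisation n = k + d + 1.
S-shaped : ∀ k d m → coeff (S (suc (k + d)) (suc k)) m ≢ + 0 →
           IsShapedMono (suc (k + d) ∸ suc k + 1) (suc (k + d) ∸ 1) (2 * suc (k + d) ∸ 1 ∸ suc k) m
S-shaped k d m c≢0 =
  subst₂ (λ N w → IsShapedMono N (k + d) w m) variables-eq weight-eq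
    (isShaped-of-coeff _ m (All.map (map₂ (shape⇒isShaped _)) (S-supported k d)) c≢0)
  where
  variables-eq : suc d ≡ suc (k + d) ∸ suc k + 1
  variables-eq = sym (trans (cong (_+ 1) (ℕP.m+n∸m≡n k d)) (ℕP.+-comm d 1))
  doubled : ∀ k d → 2 * suc (k + d) ≡ suc (suc k + (k + d + d))
  doubled = solve-∀
  weight-eq : k + d + d ≡ 2 * suc (k + d) ∸ 1 ∸ suc k
  weight-eq = sym (trans (cong (λ x → x ∸ 1 ∸ suc k) (doubled k d)) (ℕP.m+n∸m≡n (suc k) (k + d + d)))

lookup-toList : ∀ {N} (r : Vec ℕ N) (i : Fin N) → lookupOr0 (V.toList r) (toℕ i) ≡ V.lookup r i
lookup-toList (x ∷ r) F.zero = refl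
lookup-toList (x ∷ r) (F.suc i) = lookup-toList r i

lookup-toList-beyond : ∀ {N} (r : Vec ℕ N) j → N ≤ j → lookupOr0 (V.toList r) j ≡ 0
lookup-toList-beyond [] j _ = refl
lookup-toList-beyond (x ∷ r) (suc j) (s≤s N≤j) = lookup-toList-beyond r j N≤j

monoOfVec-shaped : ∀ {N s w} (r : Vec ℕ N) → 1 ≤ N → V.sum r ≡ s → wsum r ≡ w →
                   IsShapedMono N s w (monoOfList (V.toList r))
monoOfVec-shaped (x ∷ r) _ hs hw = (x ∷ r) , ex , beyond , hs , hw
  where
  ex : ∀ i → expo (monoOfList (V.toList (x ∷ r))) (toℕ i) ≡ + V.lookup (x ∷ r) i
  ex F.zero = refl
  ex (F.suc i) = trans (expo-suc (+ x) (V.toList r) (toℕ i)) (cong +_ (lookup-toList r i))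
  beyond : ∀ i → suc _ ≤ i → expo (monoOfList (V.toList (x ∷ r))) i ≡ + 0
  beyond (suc j) (s≤s N≤j) = trans (expo-suc (+ x) (V.toList r) j) (cong +_ (lookup-toList-beyond r j N≤j))

B-supported : ∀ n k → k ≤ n → Supported (IsShapedMono (n ∸ k + 1) k n) (B n k)
B-supported zero zero _ = inj₂ ((0 ∷ []) , (λ { F.zero → refl }) , (λ { zero () ; (suc i) _ → refl }) , refl , refl) ∷ []
B-supported (suc n) zero _ = []
B-supported zero (suc k) _ = []
B-supported (suc n) (suc k) _ with suc k ≤? suc n
... | no _ = []
... | yes _ =
  AllP.map⁺ (All.map (λ {r} h → inj₂ (monoOfVec-shaped r (ℕP.m≤n+m 1 (n ∸ k)) (proj₁ h) (proj₂ h)))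
    (AllP.all-filter (λ r → (V.sum r ℕ.≟ suc k) ×-dec (wsum r ℕ.≟ suc n)) (vecsUpTo (suc n ∸ suc k + 1) (suc n))))

corollary3p6 : ((n k : ℕ) → 1 ≤ n → k ≤ n → (m : Mono) → coeff (S n k) m ≢ + 0 →
    IsShapedMono (n ∸ k + 1) (n ∸ 1) (2 * n ∸ 1 ∸ k) m)
    × ((n k : ℕ) → k ≤ n → (m : Mono) → coeff (B n k) m ≢ + 0 →
    IsShapedMono (n ∸ k + 1) k n m)
corollary3p6 = partS , partB
  where
  -- S_{n,0} = 0 for n ≥ 1; otherwise write n = (k-1) + d + 1.
  partS : (n k : ℕ) → 1 ≤ n → k ≤ n → (m : Mono) → coeff (S n k) m ≢ + 0 →
          IsShapedMono (n ∸ k + 1) (n ∸ 1) (2 * n ∸ 1 ∸ k) m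
  partS (suc n) zero _ _ m c≢0 = ⊥-elim (c≢0 refl)
  partS (suc n) (suc k) _ (s≤s k≤n) = subst SClaim (ℕP.m+[n∸m]≡n k≤n) (S-shaped k (n ∸ k))
    where
    SClaim : ℕ → Set
    SClaim x = (m : Mono) → coeff (S (suc x) (suc k)) m ≢ + 0 →
               IsShapedMono (suc x ∸ suc k + 1) (suc x ∸ 1) (2 * suc x ∸ 1 ∸ suc k) m
  partB : (n k : ℕ) → k ≤ n → (m : Mono) → coeff (B n k) m ≢ + 0 → IsShapedMono (n ∸ k + 1) k n m
  partB n k k≤n m = isShaped-of-coeff (B n k) m (B-supported n k k≤n)
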